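{- Consider the mirror game on $\{1,\ldots,2n\}$ against an open-book Alice with $m$ bits of memory, where $k=0.4n$ is an integer, and suppose that on each of his turns $2,4,\ldots,2k$ Bob chooses uniformly at random (with his coins $R_B$) a number not picked so far. Let $X$ be Alice's memory state after turn $2k$. For an assignment $r_A$ of Alice's random strings, call a memory state $x\in\{0,1\}^m$ useful for $r_A$ if $\Pr_{R_B}[X=x\mid R_A=r_A]>0.9^{2n}$, and let $U_{r_A}$ be the set of memory states useful for $r_A$. If $m<0.2n$, then for every assignment $r_A$, $$\Pr_{R_B}[X\in U_{r_A}\mid R_A=r_A]\ge 1-\nu(n)$$ for a negligible function $\nu$.
   Context: Mirror game: Alice and Bob alternately name numbers from $\{1,2,\ldots,2n\}$, Alice on odd turns and Bob on even turns; a player who repeats a previously named number loses; if all $2n$ turns pass without repetition it is a draw. Open-book Alice: memory state $x\in\{0,1\}^m$; at the end of each turn $2i$ she draws a fresh random string $r_i$ of arbitrary length and thereafter has access to $(r_1,\ldots,r_i)$; her move is a function of her current memory state and random strings drawn so far, and after Bob's move her new memory state is a function of Bob's move, her current memory state, the turn number and the random strings drawn so far. Bob knows these functions, Alice's current memory state and all her random strings drawn so far, but not future ones. A function $f:\mathbb{N}\to\mathbb{R}$ is negligible if for every positive integer $c$ there is $N_c$ with $|f(x)|<x^{ -c}$ for all $x>N_c$. -}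

module Defs where

open import Data.Nat as ℕ using (ℕ; zero; suc; _<_)
open import Data.Integer using (+_)
open import Data.Fin using (Fin)
open import Data.Fin.Properties using () renaming (_≟_ to _≟F_)
open import Data.Vec using (Vec)
open import Data.Vec.Properties using (≡-dec)
open import Data.Bool using (Bool; if_then_else_)
open import Data.Bool.Properties using () renaming (_≟_ to _≟B_)
open import Data.List using (List; []; _∷_; map; filter; length; upTo; allFin; foldr)
import Data.List.Membership.DecPropositional as DecMem
open import Data.Rational using (ℚ; 0ℚ; 1ℚ; _*_; _+_; _/_; ∣_∣) renaming (_<_ to _<ℚ_)
open import Data.Rational.Properties using () renaming (_<?_ to _<ℚ?_)
open import Relation.Nullary using (¬?)
open import Relation.Nullary.Decidable using (⌊_⌋)

-- Alice's strategy in the mirror game on {1,…,2n} (numbers represented by Fin (2n)),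
-- with memory states in {0,1}^m (Vec Bool m). Random strings are List Bool; the list of
-- random strings drawn so far is passed as List (List Bool) = [r₁, …, rᵢ].
record Alice (n m : ℕ) : Set where
  field
    init   : Vec Bool m
    move   : Vec Bool m → List (List Bool) → Fin (2 ℕ.* n)
    update : Fin (2 ℕ.* n) → Vec Bool m → ℕ → List (List Bool) → Vec Bool m
      -- new memory from Bob's move, current memory, turn number, random strings so far

open Alice public

-- An assignment r_A of Alice's random strings: rA j is r_{j+1}.
-- drawn rA j = [r₁, …, r_j]
drawn : (ℕ → List Bool) → ℕ → List (List Bool)
drawn rA j = map rA (upTo j)

sumℚ : List ℚ → ℚ
sumℚ = foldr _+_ 0ℚ

avg : List ℚ → ℚ
avg [] = 0ℚ
avg (q ∷ qs) = sumℚ (q ∷ qs) * ((+ 1) / suc (length qs))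

notPicked : ∀ {n} → List (Fin n) → List (Fin n)
notPicked {n} picked = filter (λ b → ¬? (b ∈? picked)) (allFin n)
  where open DecMem (_≟F_ {n}) using (_∈?_)

-- Expectation over Bob's coins R_B (given R_A = rA) of f(X), where `left` rounds remain,
-- j rounds have been played (round j consists of Alice's turn 2j+1 and Bob's turn 2j+2),
-- `picked` is the list of numbers named so far and x is Alice's current memory state.
-- On turn 2j+1 Alice has r₁..r_j; on turn 2j+2 Bob picks uniformly among unnamed numbers,
-- r_{j+1} is drawn, and Alice updates her memory.
expect : ∀ {n m} → Alice n m → (ℕ → List Bool) → (Vec Bool m → ℚ) →
         (left j : ℕ) → List (Fin (2 ℕ.* n)) → Vec Bool m → ℚ
expect A rA f zero j picked x = f x
expect A rA f (suc left) j picked x =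
  avg (map (λ b → expect A rA f left (suc j) (b ∷ picked′)
                    (update A b x (2 ℕ.* suc j) (drawn rA (suc j))))
           (notPicked picked′))
  where
    picked′ = move A x (drawn rA j) ∷ picked

-- E_{R_B}[ f(X) | R_A = rA ], X = Alice's memory state after turn 2k
E[_∣_,_,_] : ∀ {n m} → (Vec Bool m → ℚ) → Alice n m → (ℕ → List Bool) → ℕ → ℚ
E[ f ∣ A , rA , k ] = expect A rA f k 0 [] (init A)

PrX≡ : ∀ {n m} → Alice n m → (ℕ → List Bool) → ℕ → Vec Bool m → ℚ
PrX≡ A rA k x = E[ (λ y → if ⌊ ≡-dec _≟B_ y x ⌋ then 1ℚ else 0ℚ) ∣ A , rA , k ]

powℚ : ℚ → ℕ → ℚ
powℚ q zero = 1ℚ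
powℚ q (suc e) = q * powℚ q e

threshold : ℕ → ℚ
threshold n = powℚ ((+ 9) / 10) (2 ℕ.* n)

Useful : ∀ {n m} → Alice n m → (ℕ → List Bool) → ℕ → Vec Bool m → Set
Useful {n} A rA k x = threshold n <ℚ PrX≡ A rA k x

PrUseful : ∀ {n m} → Alice n m → (ℕ → List Bool) → ℕ → ℚ
PrUseful {n} A rA k =
  E[ (λ x → if ⌊ threshold n <ℚ? PrX≡ A rA k x ⌋ then 1ℚ else 0ℚ) ∣ A , rA , k ]

-- 1/x as a rational (with 1/0 := 0, irrelevant below)
inv : ℕ → ℚ
inv zero = 0ℚ
inv (suc x) = (+ 1) / suc x

Negligible : (ℕ → ℚ) → Set
Negligible f = ∀ (c : ℕ) → 0 ℕ.< c → Σ ℕ λ N → ∀ x → N ℕ.< x → ∣ f x ∣ <ℚ inv (x ℕ.^ c)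
  where open import Data.Product using (Σ)

-- Given Alice's coins, Pr[X is not useful] is the sum, over the non-useful memory
-- states x, of Pr[X = x]; each term is at most 0.9^(2n) and there are at most 2^m
-- of them.  Since (10/9)^8 > 2 and m < n/5, 2^m · 0.9^(2n) ≤ 2^-⌊n/20⌋, which is
-- negligible.  Bob's play enters only through the fact that the expectation is an
-- iterated average, hence linear, and equals 1 on the constant 1 as long as
-- unnamed numbers remain, which k ≤ n guarantees.
module Submission where

module Fractions where

  open import Data.Nat as ℕ using (ℕ; zero; suc; NonZero; pred)
  import Data.Nat.Properties as ℕP
  open import Data.Integer as ℤ using (+_)
  import Data.Integer.Properties as ℤP
  open import Data.Rational using (ℚ; 1ℚ; _/_; _≤_; _<_; _*_; _+_; toℚᵘ)
  open import Data.Rational.Properties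
    using (toℚᵘ-fromℚᵘ; toℚᵘ-cancel-≤; toℚᵘ-cancel-<; toℚᵘ-injective; toℚᵘ-homo-*; toℚᵘ-homo-+)
  open import Data.Rational.Unnormalised using (ℚᵘ; mkℚᵘ; *≤*; *<*; *≡*; _≃_)
  import Data.Rational.Unnormalised.Properties as ℚᵘ
  open import Data.Empty using (⊥-elim-irr)
  open import Relation.Binary.PropositionalEquality

  toℚᵘ-/ : ∀ a b .{{_ : NonZero b}} → toℚᵘ (+ a / b) ≃ mkℚᵘ (+ a) (pred b)
  toℚᵘ-/ a (suc b)      = toℚᵘ-fromℚᵘ (mkℚᵘ (+ a) b)
  toℚᵘ-/ a zero {{b≢0}} = ⊥-elim-irr (NonZero.nonZero b≢0)

  private
    +-*-suc-pred : ∀ a d .{{_ : NonZero d}} → + (a ℕ.* d) ≡ + a ℤ.* + suc (pred d)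
    +-*-suc-pred a d = trans (ℤP.pos-* a d) (cong (λ e → + a ℤ.* + e) (sym (ℕP.suc-pred d)))

    ≃-representatives⇒≡ : ∀ {p q : ℚ} {p′ q′ : ℚᵘ} →
                          toℚᵘ p ≃ p′ → toℚᵘ q ≃ q′ → p′ ≃ q′ → p ≡ q
    ≃-representatives⇒≡ p≃p′ q≃q′ p′≃q′ =
      toℚᵘ-injective (ℚᵘ.≃-trans p≃p′ (ℚᵘ.≃-trans p′≃q′ (ℚᵘ.≃-sym q≃q′)))

  module _ (a b c d : ℕ) .{{_ : NonZero b}} .{{_ : NonZero d}} where

    cross-≤ : a ℕ.* d ℕ.≤ c ℕ.* b → + a / b ≤ + c / d
    cross-≤ ad≤cb = toℚᵘ-cancel-≤
      (ℚᵘ.≤-respˡ-≃ (ℚᵘ.≃-sym (toℚᵘ-/ a b)) (ℚᵘ.≤-respʳ-≃ (ℚᵘ.≃-sym (toℚᵘ-/ c d))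
        (*≤* (subst₂ ℤ._≤_ (+-*-suc-pred a d) (+-*-suc-pred c b) (ℤ.+≤+ ad≤cb)))))

    cross-< : a ℕ.* d ℕ.< c ℕ.* b → + a / b < + c / d
    cross-< ad<cb = toℚᵘ-cancel-<
      (ℚᵘ.<-respˡ-≃ (ℚᵘ.≃-sym (toℚᵘ-/ a b)) (ℚᵘ.<-respʳ-≃ (ℚᵘ.≃-sym (toℚᵘ-/ c d))
        (*<* (subst₂ ℤ._<_ (+-*-suc-pred a d) (+-*-suc-pred c b) (ℤ.+<+ ad<cb)))))

    cross-≡ : a ℕ.* d ≡ c ℕ.* b → + a / b ≡ + c / d
    cross-≡ ad≡cb = ≃-representatives⇒≡ (toℚᵘ-/ a b) (toℚᵘ-/ c d)
      (*≡* (trans (sym (+-*-suc-pred a d)) (trans (cong +_ ad≡cb) (+-*-suc-pred c b))))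

  /-homo-* : ∀ a b c d .{{_ : NonZero b}} .{{_ : NonZero d}} →
             (+ a / b) * (+ c / d) ≡ _/_ (+ (a ℕ.* c)) (b ℕ.* d) {{ℕP.m*n≢0 b d}}
  /-homo-* a (suc b) c (suc d) = ≃-representatives⇒≡
    (ℚᵘ.≃-trans (toℚᵘ-homo-* (+ a / suc b) (+ c / suc d))
                (ℚᵘ.*-cong (toℚᵘ-/ a (suc b)) (toℚᵘ-/ c (suc d))))
    (toℚᵘ-/ (a ℕ.* c) (suc b ℕ.* suc d))
    (ℚᵘ.≃-reflexive (cong (λ z → mkℚᵘ z (pred (suc b ℕ.* suc d))) (sym (ℤP.pos-* a c))))
  /-homo-* a zero    c d    {{b≢0}}       = ⊥-elim-irr (NonZero.nonZero b≢0)
  /-homo-* a (suc b) c zero {{_}} {{d≢0}} = ⊥-elim-irr (NonZero.nonZero d≢0)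

  fromℕ : ℕ → ℚ
  fromℕ a = + a / 1

  fromℕ-suc : ∀ a → fromℕ (suc a) ≡ 1ℚ + fromℕ a
  fromℕ-suc a = sym (≃-representatives⇒≡
    (ℚᵘ.≃-trans (toℚᵘ-homo-+ 1ℚ (fromℕ a)) (ℚᵘ.+-cong (toℚᵘ-/ 1 1) (toℚᵘ-/ a 1)))
    (toℚᵘ-/ (suc a) 1)
    (*≡* (cong (λ z → (+ 1 ℤ.+ z) ℤ.* + 1) (ℤP.*-identityʳ (+ a)))))

  fromℕ-suc*inverse : ∀ l → fromℕ (suc l) * (+ 1 / suc l) ≡ 1ℚ
  fromℕ-suc*inverse l = trans (/-homo-* (suc l) 1 1 (suc l))
    (cross-≡ (suc l ℕ.* 1) (1 ℕ.* suc l) 1 1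
      (trans (ℕP.*-comm (suc l ℕ.* 1) 1) (cong (1 ℕ.*_) (ℕP.*-comm (suc l) 1))))

module Sums where

  open import Defs using (sumℚ; avg)
  open Fractions using (fromℕ; fromℕ-suc; fromℕ-suc*inverse)
  open import Data.Nat using (suc)
  open import Data.Integer as ℤ using ()
  open import Data.List using (List; []; _∷_; map; length; _++_)
  open import Data.List.Properties using (length-map)
  open import Data.Rational using (ℚ; 0ℚ; 1ℚ; _+_; _*_; _/_; _≤_)
  open import Data.Rational.Properties
    using ( +-identityˡ; +-assoc; *-zeroˡ; *-zeroʳ; *-identityˡ; *-assoc; *-distribˡ-+; *-distribʳ-+
          ; ≤-refl; +-mono-≤; +-0-commutativeMonoid; *-1-commutativeMonoid)
  open import Algebra.Bundles using (CommutativeMonoid)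
  open import Algebra.Properties.CommutativeSemigroup (CommutativeMonoid.commutativeSemigroup +-0-commutativeMonoid)
    using (interchange)
  open import Algebra.Properties.CommutativeSemigroup (CommutativeMonoid.commutativeSemigroup *-1-commutativeMonoid)
    using (xy∙z≈xz∙y)
  open import Relation.Binary.PropositionalEquality
  open import Relation.Nullary using (¬_; contradiction)

  sum-++ : ∀ (xs ys : List ℚ) → sumℚ (xs ++ ys) ≡ sumℚ xs + sumℚ ys
  sum-++ []       ys = sym (+-identityˡ (sumℚ ys))
  sum-++ (x ∷ xs) ys = trans (cong (x +_) (sum-++ xs ys)) (sym (+-assoc x (sumℚ xs) (sumℚ ys)))

  module _ {B : Set} where

    sum-+ : ∀ (F G : B → ℚ) L → sumℚ (map (λ b → F b + G b) L) ≡ sumℚ (map F L) + sumℚ (map G L)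
    sum-+ F G []      = refl
    sum-+ F G (b ∷ L) = trans (cong (F b + G b +_) (sum-+ F G L)) (interchange (F b) (G b) _ _)

    sum-* : ∀ c (F : B → ℚ) L → sumℚ (map (λ b → c * F b) L) ≡ c * sumℚ (map F L)
    sum-* c F []      = sym (*-zeroʳ c)
    sum-* c F (b ∷ L) = trans (cong (c * F b +_) (sum-* c F L)) (sym (*-distribˡ-+ c (F b) _))

    sum-zero : ∀ {F : B → ℚ} → (∀ b → F b ≡ 0ℚ) → ∀ L → sumℚ (map F L) ≡ 0ℚ
    sum-zero F≡0 []      = refl
    sum-zero F≡0 (b ∷ L) = cong₂ _+_ (F≡0 b) (sum-zero F≡0 L)

    sum-const : ∀ q (L : List B) → sumℚ (map (λ _ → q) L) ≡ fromℕ (length L) * q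
    sum-const q []      = sym (*-zeroˡ q)
    sum-const q (b ∷ L) = begin
      q + sumℚ (map (λ _ → q) L)     ≡⟨ cong₂ _+_ (sym (*-identityˡ q)) (sum-const q L) ⟩
      1ℚ * q + fromℕ (length L) * q  ≡⟨ *-distribʳ-+ q 1ℚ (fromℕ (length L)) ⟨
      (1ℚ + fromℕ (length L)) * q    ≡⟨ cong (_* q) (fromℕ-suc (length L)) ⟨
      fromℕ (suc (length L)) * q     ∎
      where open ≡-Reasoning

    sum-mono-≤ : ∀ {F G : B → ℚ} → (∀ b → F b ≤ G b) → ∀ L → sumℚ (map F L) ≤ sumℚ (map G L)
    sum-mono-≤ F≤G []      = ≤-refl
    sum-mono-≤ F≤G (b ∷ L) = +-mono-≤ (F≤G b) (sum-mono-≤ F≤G L)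

    private
      weight : List B → ℚ
      weight []      = 0ℚ
      weight (_ ∷ L) = ℤ.+ 1 / suc (length L)

      avg-map : ∀ (F : B → ℚ) L → avg (map F L) ≡ sumℚ (map F L) * weight L
      avg-map F []      = refl
      avg-map F (b ∷ L) = cong (λ l → sumℚ (map F (b ∷ L)) * (ℤ.+ 1 / suc l)) (length-map F L)

    avg-+ : ∀ (F G : B → ℚ) L → avg (map (λ b → F b + G b) L) ≡ avg (map F L) + avg (map G L)
    avg-+ F G L = begin
      avg (map (λ b → F b + G b) L)                          ≡⟨ avg-map (λ b → F b + G b) L ⟩
      sumℚ (map (λ b → F b + G b) L) * weight L              ≡⟨ cong (_* weight L) (sum-+ F G L) ⟩
      (sumℚ (map F L) + sumℚ (map G L)) * weight L           ≡⟨ *-distribʳ-+ (weight L) (sumℚ (map F L)) _ ⟩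
      sumℚ (map F L) * weight L + sumℚ (map G L) * weight L  ≡⟨ cong₂ _+_ (avg-map F L) (avg-map G L) ⟨
      avg (map F L) + avg (map G L)                          ∎
      where open ≡-Reasoning

    avg-* : ∀ c (F : B → ℚ) L → avg (map (λ b → c * F b) L) ≡ c * avg (map F L)
    avg-* c F L = begin
      avg (map (λ b → c * F b) L)              ≡⟨ avg-map (λ b → c * F b) L ⟩
      sumℚ (map (λ b → c * F b) L) * weight L  ≡⟨ cong (_* weight L) (sum-* c F L) ⟩
      c * sumℚ (map F L) * weight L            ≡⟨ *-assoc c (sumℚ (map F L)) (weight L) ⟩
      c * (sumℚ (map F L) * weight L)          ≡⟨ cong (c *_) (avg-map F L) ⟨
      c * avg (map F L)                        ∎
      where open ≡-Reasoning

    avg-const : ∀ q (L : List B) → ¬ L ≡ [] → avg (map (λ _ → q) L) ≡ q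
    avg-const q []      []≢[] = contradiction refl []≢[]
    avg-const q (b ∷ L) _     = begin
      avg (map (λ _ → q) (b ∷ L))                      ≡⟨ avg-map (λ _ → q) (b ∷ L) ⟩
      sumℚ (map (λ _ → q) (b ∷ L)) * weight (b ∷ L)  ≡⟨ cong (_* weight (b ∷ L)) (sum-const q (b ∷ L)) ⟩
      fromℕ (suc (length L)) * q * weight (b ∷ L)    ≡⟨ xy∙z≈xz∙y (fromℕ (suc (length L))) q _ ⟩
      fromℕ (suc (length L)) * weight (b ∷ L) * q    ≡⟨ cong (_* q) (fromℕ-suc*inverse (length L)) ⟩
      1ℚ * q                                         ≡⟨ *-identityˡ q ⟩
      q                                              ∎
      where open ≡-Reasoning

module Moves where

  open import Defs using (notPicked)
  open import Data.Nat using (ℕ; _<_)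
  open import Data.Fin using (Fin)
  open import Data.Fin.Properties using (pigeonhole; <-irrefl) renaming (_≟_ to _≟ᶠ_)
  open import Data.List using (List; []; length; lookup)
  open import Data.List.Membership.Propositional using (_∈_)
  open import Data.List.Membership.Propositional.Properties using (∈-filter⁺; ∈-allFin)
  import Data.List.Membership.DecPropositional as DecMembership
  open import Data.List.Relation.Unary.Any using (index)
  open import Data.List.Relation.Unary.Any.Properties using (lookup-index)
  open import Data.Product using (_,_)
  open import Relation.Nullary using (¬_; ¬?; yes; no)
  open import Relation.Binary.PropositionalEquality

  module _ {N : ℕ} where

    open DecMembership (_≟ᶠ_ {N}) using (_∈?_)

    notPicked≡[]⇒picked : (L : List (Fin N)) → notPicked L ≡ [] → ∀ i → i ∈ L
    notPicked≡[]⇒picked L none i with i ∈? L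
    ... | yes i∈L = i∈L
    ... | no  i∉L with () ← subst (i ∈_) none (∈-filter⁺ (λ b → ¬? (b ∈? L)) (∈-allFin i) i∉L)

  -- Otherwise the positions in L of all N numbers would be N distinct indices below length L.
  notPicked-nonempty : ∀ {N} (L : List (Fin N)) → length L < N → ¬ notPicked L ≡ []
  notPicked-nonempty {N} L L<N none =
    let i , j , i<j , same-position = pigeonhole L<N position in
    <-irrefl (trans (lookup-position i) (trans (cong (lookup L) same-position) (sym (lookup-position j)))) i<j
    where
    position : Fin N → Fin (length L)
    position i = index (notPicked≡[]⇒picked L none i)

    lookup-position : ∀ i → i ≡ lookup L (position i)
    lookup-position i = lookup-index (notPicked≡[]⇒picked L none i)

module Expectation where

  open import Defs using (Alice; move; drawn; update; expect; notPicked; avg; sumℚ)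
  open Sums using (avg-+; avg-*; avg-const)
  open Moves using (notPicked-nonempty)
  open import Data.Nat as ℕ using (ℕ; zero; suc; _≤_)
  import Data.Nat.Properties as ℕP
  open import Data.Nat.Tactic.RingSolver using (solve-∀)
  open import Data.Fin using (Fin)
  open import Data.Vec using (Vec)
  open import Data.Bool using (Bool)
  open import Data.List using (List; []; _∷_; map; length)
  open import Data.List.Properties using (map-cong)
  open import Data.Rational using (ℚ; 0ℚ; _+_; _*_)
  open import Data.Rational.Properties using (*-zeroˡ)
  open import Relation.Binary.PropositionalEquality

  module _ {n m} (A : Alice n m) (rA : ℕ → List Bool) where

    private
      E : (Vec Bool m → ℚ) → (left j : ℕ) → List (Fin (2 ℕ.* n)) → Vec Bool m → ℚ
      E = expect A rA

      named : ℕ → List (Fin (2 ℕ.* n)) → Vec Bool m → List (Fin (2 ℕ.* n))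
      named j p x = move A x (drawn rA j) ∷ p

      bobMoves : ℕ → List (Fin (2 ℕ.* n)) → Vec Bool m → List (Fin (2 ℕ.* n))
      bobMoves j p x = notPicked (named j p x)

      afterBob : (Vec Bool m → ℚ) → (left j : ℕ) → List (Fin (2 ℕ.* n)) → Vec Bool m → Fin (2 ℕ.* n) → ℚ
      afterBob f l j p x b = E f l (suc j) (b ∷ named j p x) (update A b x (2 ℕ.* suc j) (drawn rA (suc j)))

    expect-cong : ∀ {f g : Vec Bool m → ℚ} → (∀ y → f y ≡ g y) → ∀ l j p x → E f l j p x ≡ E g l j p x
    expect-cong f≗g zero    j p x = f≗g x
    expect-cong f≗g (suc l) j p x =
      cong avg (map-cong (λ b → expect-cong f≗g l (suc j) (b ∷ named j p x) _) (bobMoves j p x))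

    expect-+ : ∀ (f g : Vec Bool m → ℚ) l j p x → E (λ y → f y + g y) l j p x ≡ E f l j p x + E g l j p x
    expect-+ f g zero    j p x = refl
    expect-+ f g (suc l) j p x = trans
      (cong avg (map-cong (λ b → expect-+ f g l (suc j) (b ∷ named j p x) _) (bobMoves j p x)))
      (avg-+ (afterBob f l j p x) (afterBob g l j p x) (bobMoves j p x))

    expect-* : ∀ c (f : Vec Bool m → ℚ) l j p x → E (λ y → c * f y) l j p x ≡ c * E f l j p x
    expect-* c f zero    j p x = refl
    expect-* c f (suc l) j p x = trans
      (cong avg (map-cong (λ b → expect-* c f l (suc j) (b ∷ named j p x) _) (bobMoves j p x)))
      (avg-* c (afterBob f l j p x) (bobMoves j p x))

    expect-zero : ∀ l j p x → E (λ _ → 0ℚ) l j p x ≡ 0ℚ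
    expect-zero l j p x = begin
      E (λ _ → 0ℚ) l j p x       ≡⟨ expect-cong (λ _ → sym (*-zeroˡ 0ℚ)) l j p x ⟩
      E (λ _ → 0ℚ * 0ℚ) l j p x  ≡⟨ expect-* 0ℚ (λ _ → 0ℚ) l j p x ⟩
      0ℚ * E (λ _ → 0ℚ) l j p x  ≡⟨ *-zeroˡ (E (λ _ → 0ℚ) l j p x) ⟩
      0ℚ                         ∎
      where open ≡-Reasoning

    expect-sum : ∀ {X : Set} (h : X → Vec Bool m → ℚ) (L : List X) l j p x →
                 E (λ y → sumℚ (map (λ z → h z y) L)) l j p x ≡ sumℚ (map (λ z → E (h z) l j p x) L)
    expect-sum h []      l j p x = expect-zero l j p x
    expect-sum h (z ∷ L) l j p x =
      trans (expect-+ (h z) _ l j p x) (cong (E (h z) l j p x +_) (expect-sum h L l j p x))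

    expect-const : ∀ q l j p x → length p ℕ.+ 2 ℕ.* l ≤ 2 ℕ.* n → E (λ _ → q) l j p x ≡ q
    expect-const q zero    j p x _    = refl
    expect-const q (suc l) j p x room = trans
      (cong avg (map-cong (λ b → expect-const q l (suc j) (b ∷ named j p x) _ room′) (bobMoves j p x)))
      (avg-const q (bobMoves j p x) (notPicked-nonempty (named j p x) named<2n))
      where
      two-per-round : ∀ a l → a ℕ.+ 2 ℕ.* suc l ≡ suc (suc a) ℕ.+ 2 ℕ.* l
      two-per-round = solve-∀

      room′ : suc (suc (length p)) ℕ.+ 2 ℕ.* l ≤ 2 ℕ.* n
      room′ = ℕP.≤-trans (ℕP.≤-reflexive (sym (two-per-round (length p) l))) room

      named<2n : suc (length p) ℕ.< 2 ℕ.* n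
      named<2n = ℕP.≤-trans (ℕP.m≤m+n _ (2 ℕ.* l)) room′

module MemoryStates where

  open import Defs using (sumℚ)
  open Sums using (sum-++; sum-zero)
  open import Data.Nat as ℕ using (ℕ; zero; suc; _^_)
  import Data.Nat.Properties as ℕP
  open import Data.Vec using (Vec; []; _∷_)
  open import Data.Vec.Properties using (≡-dec)
  open import Data.Bool using (Bool; true; false; if_then_else_)
  open import Data.Bool.Properties using (_≟_)
  open import Data.List using (List; []; _∷_; map; length; _++_)
  open import Data.List.Properties using (length-++; length-map; map-++; map-∘)
  open import Data.Rational using (ℚ; 0ℚ; 1ℚ; _+_; _*_)
  open import Data.Rational.Properties using (*-zeroʳ; *-identityʳ; +-identityʳ; +-identityˡ)
  open import Function using (_∘_)
  open import Relation.Nullary using (does)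
  open import Relation.Binary.PropositionalEquality

  allVecs : ∀ m → List (Vec Bool m)
  allVecs zero    = [] ∷ []
  allVecs (suc m) = map (true ∷_) (allVecs m) ++ map (false ∷_) (allVecs m)

  length-allVecs : ∀ m → length (allVecs m) ≡ 2 ^ m
  length-allVecs zero    = refl
  length-allVecs (suc m) = begin
    length (map (true ∷_) (allVecs m) ++ map (false ∷_) (allVecs m))
      ≡⟨ length-++ (map (true ∷_) (allVecs m)) ⟩
    length (map (true ∷_) (allVecs m)) ℕ.+ length (map (false ∷_) (allVecs m))
      ≡⟨ cong₂ ℕ._+_ (length-map (true ∷_) (allVecs m)) (length-map (false ∷_) (allVecs m)) ⟩
    length (allVecs m) ℕ.+ length (allVecs m)
      ≡⟨ cong₂ ℕ._+_ (length-allVecs m) (trans (length-allVecs m) (sym (ℕP.+-identityʳ (2 ^ m)))) ⟩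
    2 ^ suc m ∎
    where open ≡-Reasoning

  sum-allVecs-suc : ∀ m (F : Vec Bool (suc m) → ℚ) →
    sumℚ (map F (allVecs (suc m))) ≡
    sumℚ (map (F ∘ (true ∷_)) (allVecs m)) + sumℚ (map (F ∘ (false ∷_)) (allVecs m))
  sum-allVecs-suc m F = begin
    sumℚ (map F (map (true ∷_) (allVecs m) ++ map (false ∷_) (allVecs m)))
      ≡⟨ cong sumℚ (map-++ F (map (true ∷_) (allVecs m)) (map (false ∷_) (allVecs m))) ⟩
    sumℚ (map F (map (true ∷_) (allVecs m)) ++ map F (map (false ∷_) (allVecs m)))
      ≡⟨ sum-++ (map F (map (true ∷_) (allVecs m))) (map F (map (false ∷_) (allVecs m))) ⟩
    sumℚ (map F (map (true ∷_) (allVecs m))) + sumℚ (map F (map (false ∷_) (allVecs m)))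
      ≡⟨ cong₂ _+_ (cong sumℚ (map-∘ (allVecs m))) (cong sumℚ (map-∘ (allVecs m))) ⟨
    sumℚ (map (F ∘ (true ∷_)) (allVecs m)) + sumℚ (map (F ∘ (false ∷_)) (allVecs m)) ∎
    where open ≡-Reasoning

  -- Stated with `does` rather than ⌊_⌋ (as in PrX≡) because `does` computes on ∷:
  -- δ (b ∷ x) (c ∷ y) reduces to δ x y or to 0ℚ.
  δ : ∀ {m} → Vec Bool m → Vec Bool m → ℚ
  δ x y = if does (≡-dec _≟_ y x) then 1ℚ else 0ℚ

  sum-δ : ∀ m (f : Vec Bool m → ℚ) y → sumℚ (map (λ x → f x * δ x y) (allVecs m)) ≡ f y
  sum-δ zero    f []          = trans (+-identityʳ (f [] * 1ℚ)) (*-identityʳ (f []))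
  sum-δ (suc m) f (true ∷ y)  = begin
    sumℚ (map (λ x → f x * δ x (true ∷ y)) (allVecs (suc m)))
      ≡⟨ sum-allVecs-suc m (λ x → f x * δ x (true ∷ y)) ⟩
    sumℚ (map (λ x → f (true ∷ x) * δ x y) (allVecs m)) + sumℚ (map (λ x → f (false ∷ x) * 0ℚ) (allVecs m))
      ≡⟨ cong₂ _+_ (sum-δ m (f ∘ (true ∷_)) y) (sum-zero (λ x → *-zeroʳ (f (false ∷ x))) (allVecs m)) ⟩
    f (true ∷ y) + 0ℚ
      ≡⟨ +-identityʳ (f (true ∷ y)) ⟩
    f (true ∷ y) ∎
    where open ≡-Reasoning
  sum-δ (suc m) f (false ∷ y) = begin
    sumℚ (map (λ x → f x * δ x (false ∷ y)) (allVecs (suc m)))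
      ≡⟨ sum-allVecs-suc m (λ x → f x * δ x (false ∷ y)) ⟩
    sumℚ (map (λ x → f (true ∷ x) * 0ℚ) (allVecs m)) + sumℚ (map (λ x → f (false ∷ x) * δ x y) (allVecs m))
      ≡⟨ cong₂ _+_ (sum-zero (λ x → *-zeroʳ (f (true ∷ x))) (allVecs m)) (sum-δ m (f ∘ (false ∷_)) y) ⟩
    0ℚ + f (false ∷ y)
      ≡⟨ +-identityˡ (f (false ∷ y)) ⟩
    f (false ∷ y) ∎
    where open ≡-Reasoning
module GrowthEstimates where

  open import Data.Nat
  open import Data.Nat.Properties
  open import Data.Nat.DivMod
  open import Data.Nat.Tactic.RingSolver using (solve-∀)
  open import Data.Product using (Σ; _,_)
  open import Relation.Binary.PropositionalEquality

  private
    square≤2^-from4 : ∀ d → (d + 4) * (d + 4) ≤ 2 ^ (d + 4)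
    square≤2^-from4 zero    = ≤-refl
    square≤2^-from4 (suc d) = begin
      suc p * suc p                           ≤⟨ m≤m+n (suc p * suc p) (d * d + 6 * d + 7) ⟩
      suc p * suc p + (d * d + 6 * d + 7)     ≡⟨ square-step d ⟩
      p * p + p * p                           ≤⟨ +-mono-≤ (square≤2^-from4 d) (square≤2^-from4 d) ⟩
      2 ^ p + 2 ^ p                           ≡⟨ cong (2 ^ p +_) (+-identityʳ (2 ^ p)) ⟨
      2 ^ suc p                               ∎
      where
      open ≤-Reasoning
      p = d + 4
      square-step : ∀ d → suc (d + 4) * suc (d + 4) + (d * d + 6 * d + 7) ≡ (d + 4) * (d + 4) + (d + 4) * (d + 4)
      square-step = solve-∀

    m<[1+m/n]*n : ∀ m n .{{_ : NonZero n}} → m < suc (m / n) * n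
    m<[1+m/n]*n m n = begin-strict
      m                  ≡⟨ m≡m%n+[m/n]*n m n ⟩
      m % n + m / n * n  <⟨ +-monoˡ-< (m / n * n) (m%n<n m n) ⟩
      n + m / n * n      ∎
      where open ≤-Reasoning

  square≤2^ : ∀ q → 4 ≤ q → q * q ≤ 2 ^ q
  square≤2^ q 4≤q = subst (λ q → q * q ≤ 2 ^ q) (m∸n+n≡m 4≤q) (square≤2^-from4 (q ∸ 4))

  linear<2^ : ∀ K q → K + 4 ≤ q → K * suc q < 2 ^ q
  linear<2^ K q K+4≤q =
    subst (λ q → K * suc q < 2 ^ q) (trans (+-comm (K + 4) (q ∸ (K + 4))) (m∸n+n≡m K+4≤q)) (from-K+4 (q ∸ (K + 4)))
    where
    square-expansion : ∀ K e → (K + 4 + e) * (K + 4 + e) ≡ suc (K * suc (K + 4 + e) + (3 * K + K * e + 8 * e + e * e + 15))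
    square-expansion = solve-∀

    from-K+4 : ∀ e → K * suc (K + 4 + e) < 2 ^ (K + 4 + e)
    from-K+4 e = <-≤-trans
      (subst (K * suc (K + 4 + e) <_) (sym (square-expansion K e)) (s≤s (m≤m+n _ _)))
      (square≤2^ (K + 4 + e) (≤-trans (m≤n+m 4 K) (m≤m+n _ e)))

  -- With y = x / 20 and q = y / c we have x ≤ 20c(q + 1), and 20c(q + 1) < 2^q as soon
  -- as q ≥ 20c + 4, which holds once x > 20c(20c + 4); then x^c < 2^(qc) ≤ 2^y.
  pow<2^[/20] : ∀ c → 0 < c → Σ ℕ λ N → ∀ x → N < x → x ^ c < 2 ^ (x / 20)
  pow<2^[/20] c@(suc _) _ = Q * c * 20 , bound
    where
    K = 20 * c
    Q = K + 4

    bound : ∀ x → Q * c * 20 < x → x ^ c < 2 ^ (x / 20)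
    bound x N<x = begin-strict
      x ^ c              ≤⟨ ^-monoˡ-≤ c x≤K[q+1] ⟩
      (K * suc q) ^ c    <⟨ ^-monoˡ-< c (linear<2^ K q Q≤q) ⟩
      (2 ^ q) ^ c        ≡⟨ ^-*-assoc 2 q c ⟩
      2 ^ (q * c)        ≤⟨ ^-monoʳ-≤ 2 (m/n*n≤m y c) ⟩
      2 ^ y              ∎
      where
      open ≤-Reasoning
      y = x / 20
      q = y / c

      rearrange : ∀ q c → q * c * 20 ≡ 20 * c * q
      rearrange = solve-∀

      x≤K[q+1] : x ≤ K * suc q
      x≤K[q+1] = begin
        x                ≤⟨ <⇒≤ (m<[1+m/n]*n x 20) ⟩
        suc y * 20       ≤⟨ *-monoˡ-≤ 20 (m<[1+m/n]*n y c) ⟩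
        suc q * c * 20   ≡⟨ rearrange (suc q) c ⟩
        K * suc q        ∎

      Q≤q : Q ≤ q
      Q≤q = begin
        Q                    ≡⟨ m*n/n≡m Q c ⟨
        Q * c / c            ≡⟨ cong (_/ c) (m*n/n≡m (Q * c) 20) ⟨
        Q * c * 20 / 20 / c  ≤⟨ /-monoˡ-≤ c (/-monoˡ-≤ 20 (<⇒≤ N<x)) ⟩
        q                    ∎

  ^-distribʳ-* : ∀ a b k → (a * b) ^ k ≡ a ^ k * b ^ k
  ^-distribʳ-* a b zero    = refl
  ^-distribʳ-* a b (suc k) = trans (cong (a * b *_) (^-distribʳ-* a b k)) (interchange a b (a ^ k) (b ^ k))
    where
    interchange : ∀ a b x y → a * b * (x * y) ≡ a * x * (b * y)
    interchange = solve-∀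

  2^e*9^[2n]≤10^[2n] : ∀ e n → 4 * e ≤ n → 2 ^ e * 9 ^ (2 * n) ≤ 10 ^ (2 * n)
  2^e*9^[2n]≤10^[2n] e n 4e≤n = begin
    2 ^ e * 9 ^ (2 * n)              ≡⟨ cong (λ t → 2 ^ e * 9 ^ t) split ⟩
    2 ^ e * 9 ^ (8 * e + r)          ≡⟨ cong (2 ^ e *_) (^-distribˡ-+-* 9 (8 * e) r) ⟩
    2 ^ e * (9 ^ (8 * e) * 9 ^ r)    ≡⟨ *-assoc (2 ^ e) (9 ^ (8 * e)) (9 ^ r) ⟨
    2 ^ e * 9 ^ (8 * e) * 9 ^ r      ≡⟨ cong (λ t → 2 ^ e * t * 9 ^ r) (^-*-assoc 9 8 e) ⟨
    2 ^ e * (9 ^ 8) ^ e * 9 ^ r      ≡⟨ cong (_* 9 ^ r) (^-distribʳ-* 2 (9 ^ 8) e) ⟨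
    (2 * 9 ^ 8) ^ e * 9 ^ r          ≤⟨ *-mono-≤ (^-monoˡ-≤ e (≤ᵇ⇒≤ (2 * 9 ^ 8) (10 ^ 8) _))
                                                  (^-monoˡ-≤ r (≤ᵇ⇒≤ 9 10 _)) ⟩
    (10 ^ 8) ^ e * 10 ^ r            ≡⟨ cong (_* 10 ^ r) (^-*-assoc 10 8 e) ⟩
    10 ^ (8 * e) * 10 ^ r            ≡⟨ ^-distribˡ-+-* 10 (8 * e) r ⟨
    10 ^ (8 * e + r)                 ≡⟨ cong (10 ^_) split ⟨
    10 ^ (2 * n)                     ∎
    where
    open ≤-Reasoning
    r = 2 * n ∸ 8 * e

    eight : ∀ e → 8 * e ≡ 2 * (4 * e)
    eight = solve-∀

    split : 2 * n ≡ 8 * e + r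
    split = sym (m+[n∸m]≡n (≤-trans (≤-reflexive (eight e)) (*-monoʳ-≤ 2 4e≤n)))

  memory-budget : ∀ m n → 5 * m < n → 2 ^ m * 9 ^ (2 * n) * 2 ^ (n / 20) ≤ 10 ^ (2 * n)
  memory-budget m n 5m<n = begin
    2 ^ m * 9 ^ (2 * n) * 2 ^ d     ≡⟨ swap (2 ^ m) (9 ^ (2 * n)) (2 ^ d) ⟩
    2 ^ m * 2 ^ d * 9 ^ (2 * n)     ≡⟨ cong (_* 9 ^ (2 * n)) (^-distribˡ-+-* 2 m d) ⟨
    2 ^ (m + d) * 9 ^ (2 * n)       ≤⟨ 2^e*9^[2n]≤10^[2n] (m + d) n 4[m+d]≤n ⟩
    10 ^ (2 * n)                    ∎
    where
    open ≤-Reasoning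
    d = n / 20

    swap : ∀ a b c → a * b * c ≡ a * c * b
    swap = solve-∀

    expand : ∀ m d → 5 * (4 * (m + d)) ≡ 4 * (5 * m) + d * 20
    expand = solve-∀

    collect : ∀ n → 4 * n + n ≡ 5 * n
    collect = solve-∀

    4[m+d]≤n : 4 * (m + d) ≤ n
    4[m+d]≤n = *-cancelˡ-≤ 5 (begin
      5 * (4 * (m + d))      ≡⟨ expand m d ⟩
      4 * (5 * m) + d * 20   ≤⟨ +-mono-≤ (*-monoʳ-≤ 4 (<⇒≤ 5m<n)) (m/n*n≤m n 20) ⟩
      4 * n + n              ≡⟨ collect n ⟩
      5 * n                  ∎)

module ErrorBound where

  open import Defs using (Negligible; inv; powℚ; threshold)
  open Fractions using (cross-≤; cross-<; /-homo-*; fromℕ)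
  open GrowthEstimates using (pow<2^[/20]; memory-budget)
  open import Data.Nat as ℕ using (ℕ; zero; suc; NonZero; _^_)
  import Data.Nat.Properties as ℕP
  open import Data.Integer using (+_)
  open import Data.Rational using (ℚ; 0ℚ; _*_; _/_; _≤_; _<_; ∣_∣)
  open import Data.Rational.Properties using (0≤p⇒∣p∣≡p; module ≤-Reasoning)
  open import Data.Product using (_,_)
  open import Relation.Binary.PropositionalEquality

  ν : ℕ → ℚ
  ν n = _/_ (+ 1) (2 ^ (n ℕ./ 20)) {{ℕP.m^n≢0 2 (n ℕ./ 20)}}

  ν<inv : ∀ c x .{{_ : NonZero x}} → x ^ c ℕ.< 2 ^ (x ℕ./ 20) → ∣ ν x ∣ < inv (x ^ c)
  ν<inv c x x^c<2^[x/20] = subst₂ _<_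
    (sym (0≤p⇒∣p∣≡p (cross-≤ 0 1 1 (2 ^ (x ℕ./ 20)) {{_}} {{2^[x/20]≢0}} ℕ.z≤n)))
    (sym (inv-nonZero (x ^ c) {{x^c≢0}}))
    (cross-< 1 (2 ^ (x ℕ./ 20)) 1 (x ^ c) {{2^[x/20]≢0}} {{x^c≢0}}
      (subst₂ ℕ._<_ (sym (ℕP.*-identityˡ (x ^ c))) (sym (ℕP.*-identityˡ (2 ^ (x ℕ./ 20)))) x^c<2^[x/20]))
    where
    2^[x/20]≢0 = ℕP.m^n≢0 2 (x ℕ./ 20)
    x^c≢0      = ℕP.m^n≢0 x c

    inv-nonZero : ∀ y .{{_ : NonZero y}} → inv y ≡ + 1 / y
    inv-nonZero (suc y) = refl

  ν-negligible : Negligible ν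
  ν-negligible c 0<c =
    let N , bound = pow<2^[/20] c 0<c in
    N , λ x N<x → ν<inv c x {{ℕ.>-nonZero (ℕP.≤-<-trans ℕ.z≤n N<x)}} (bound x N<x)

  powℚ-/ : ∀ a b e .{{_ : NonZero b}} → powℚ (+ a / b) e ≡ _/_ (+ (a ^ e)) (b ^ e) {{ℕP.m^n≢0 b e}}
  powℚ-/ a b zero              = refl
  powℚ-/ a b (suc e) {{b≢0}} = trans (cong (+ a / b *_) (powℚ-/ a b e))
    (/-homo-* a b (a ^ e) (b ^ e) {{b≢0}} {{ℕP.m^n≢0 b e}})

  module _ (n : ℕ) where

    private
      D = 10 ^ (2 ℕ.* n)
      D≢0 = ℕP.m^n≢0 10 (2 ℕ.* n)
      1*D≢0 = ℕP.m*n≢0 1 D {{_}} {{D≢0}}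

    0≤threshold : 0ℚ ≤ threshold n
    0≤threshold = subst (0ℚ ≤_) (sym (powℚ-/ 9 10 (2 ℕ.* n)))
      (cross-≤ 0 1 (9 ^ (2 ℕ.* n)) D {{_}} {{D≢0}} ℕ.z≤n)

    2^m*threshold≤ν : ∀ m → 5 ℕ.* m ℕ.< n → fromℕ (2 ^ m) * threshold n ≤ ν n
    2^m*threshold≤ν m 5m<n = begin
      fromℕ (2 ^ m) * threshold n
        ≡⟨ cong (fromℕ (2 ^ m) *_) (powℚ-/ 9 10 (2 ℕ.* n)) ⟩
      fromℕ (2 ^ m) * _/_ (+ (9 ^ (2 ℕ.* n))) D {{D≢0}}
        ≡⟨ /-homo-* (2 ^ m) 1 (9 ^ (2 ℕ.* n)) D {{_}} {{D≢0}} ⟩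
      _/_ (+ (2 ^ m ℕ.* 9 ^ (2 ℕ.* n))) (1 ℕ.* D) {{1*D≢0}}
        ≤⟨ cross-≤ (2 ^ m ℕ.* 9 ^ (2 ℕ.* n)) (1 ℕ.* D) 1 (2 ^ (n ℕ./ 20))
             {{1*D≢0}} {{ℕP.m^n≢0 2 (n ℕ./ 20)}}
             (subst (2 ^ m ℕ.* 9 ^ (2 ℕ.* n) ℕ.* 2 ^ (n ℕ./ 20) ℕ.≤_)
               (sym (trans (ℕP.*-identityˡ (1 ℕ.* D)) (ℕP.*-identityˡ D))) (memory-budget m n 5m<n)) ⟩
      ν n ∎
      where open ≤-Reasoning

module UsefulStates where

  open import Defs
  open Fractions using (fromℕ)
  open Sums using (sum-mono-≤; sum-const)
  open Expectation using (expect-cong; expect-sum; expect-*; expect-+; expect-const)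
  open MemoryStates using (allVecs; length-allVecs; δ; sum-δ)
  open ErrorBound using (ν; 0≤threshold; 2^m*threshold≤ν)
  open import Data.Nat as ℕ using (ℕ; _^_)
  import Data.Nat.Properties as ℕP
  open import Data.Vec using (Vec)
  open import Data.Bool using (Bool; if_then_else_)
  open import Data.List using (List; []; map; length)
  open import Data.List.Properties using (map-cong)
  open import Data.Rational using (ℚ; 0ℚ; 1ℚ; _+_; _-_; _*_; _≤_)
  open import Data.Rational.Properties
    using (_<?_; ≮⇒≥; ≤-trans; *-zeroˡ; *-identityˡ; +-0-group; module ≤-Reasoning)
  open import Algebra.Properties.Group +-0-group using (//-rightDividesʳ)
  open import Relation.Nullary using (yes; no)
  open import Relation.Nullary.Decidable using (⌊_⌋; isYes≗does)
  open import Relation.Binary.PropositionalEquality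

  module _ {n m} (A : Alice n m) (rA : ℕ → List Bool) (k : ℕ) where

    useful : Vec Bool m → ℚ
    useful x = if ⌊ threshold n <? PrX≡ A rA k x ⌋ then 1ℚ else 0ℚ

    notUseful : Vec Bool m → ℚ
    notUseful x = if ⌊ threshold n <? PrX≡ A rA k x ⌋ then 0ℚ else 1ℚ

    PrNotUseful : ℚ
    PrNotUseful = E[ notUseful ∣ A , rA , k ]

    E-by-states : ∀ f → E[ f ∣ A , rA , k ] ≡ sumℚ (map (λ x → f x * PrX≡ A rA k x) (allVecs m))
    E-by-states f = begin
      E[ f ∣ A , rA , k ]
        ≡⟨ expect-cong A rA (λ y → sym (sum-δ m f y)) k 0 [] (init A) ⟩
      E[ (λ y → sumℚ (map (λ x → f x * δ x y) (allVecs m))) ∣ A , rA , k ]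
        ≡⟨ expect-sum A rA (λ x y → f x * δ x y) (allVecs m) k 0 [] (init A) ⟩
      sumℚ (map (λ x → E[ (λ y → f x * δ x y) ∣ A , rA , k ]) (allVecs m))
        ≡⟨ cong sumℚ (map-cong E[f*δ]≡f*PrX≡ (allVecs m)) ⟩
      sumℚ (map (λ x → f x * PrX≡ A rA k x) (allVecs m)) ∎
      where
      open ≡-Reasoning
      E[δ]≡PrX≡ : ∀ x → E[ δ x ∣ A , rA , k ] ≡ PrX≡ A rA k x
      E[δ]≡PrX≡ x = expect-cong A rA (λ y → cong (if_then 1ℚ else 0ℚ) (sym (isYes≗does _))) k 0 [] (init A)

      E[f*δ]≡f*PrX≡ : ∀ x → E[ (λ y → f x * δ x y) ∣ A , rA , k ] ≡ f x * PrX≡ A rA k x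
      E[f*δ]≡f*PrX≡ x = trans (expect-* A rA (f x) (δ x) k 0 [] (init A)) (cong (f x *_) (E[δ]≡PrX≡ x))

    PrUseful≡1-PrNotUseful : k ℕ.≤ n → PrUseful A rA k ≡ 1ℚ - PrNotUseful
    PrUseful≡1-PrNotUseful k≤n = begin
      PrUseful A rA k
        ≡⟨ //-rightDividesʳ PrNotUseful (PrUseful A rA k) ⟨
      PrUseful A rA k + PrNotUseful - PrNotUseful
        ≡⟨ cong (_- PrNotUseful) (expect-+ A rA useful notUseful k 0 [] (init A)) ⟨
      E[ (λ x → useful x + notUseful x) ∣ A , rA , k ] - PrNotUseful
        ≡⟨ cong (_- PrNotUseful) (expect-cong A rA useful+notUseful≡1 k 0 [] (init A)) ⟩
      E[ (λ _ → 1ℚ) ∣ A , rA , k ] - PrNotUseful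
        ≡⟨ cong (_- PrNotUseful) (expect-const A rA 1ℚ k 0 [] (init A) (ℕP.*-monoʳ-≤ 2 k≤n)) ⟩
      1ℚ - PrNotUseful
        ∎
      where
      open ≡-Reasoning
      useful+notUseful≡1 : ∀ x → useful x + notUseful x ≡ 1ℚ
      useful+notUseful≡1 x with threshold n <? PrX≡ A rA k x
      ... | yes _ = refl
      ... | no  _ = refl

    PrNotUseful≤2^m*threshold : PrNotUseful ≤ fromℕ (2 ^ m) * threshold n
    PrNotUseful≤2^m*threshold = begin
      PrNotUseful
        ≡⟨ E-by-states notUseful ⟩
      sumℚ (map (λ x → notUseful x * PrX≡ A rA k x) (allVecs m))
        ≤⟨ sum-mono-≤ notUseful*Pr≤threshold (allVecs m) ⟩
      sumℚ (map (λ _ → threshold n) (allVecs m))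
        ≡⟨ sum-const (threshold n) (allVecs m) ⟩
      fromℕ (length (allVecs m)) * threshold n
        ≡⟨ cong (λ l → fromℕ l * threshold n) (length-allVecs m) ⟩
      fromℕ (2 ^ m) * threshold n
        ∎
      where
      open ≤-Reasoning
      notUseful*Pr≤threshold : ∀ x → notUseful x * PrX≡ A rA k x ≤ threshold n
      notUseful*Pr≤threshold x with threshold n <? PrX≡ A rA k x
      ... | yes _          = subst (_≤ threshold n) (sym (*-zeroˡ (PrX≡ A rA k x))) (0≤threshold n)
      ... | no  not-useful = subst (_≤ threshold n) (sym (*-identityˡ (PrX≡ A rA k x))) (≮⇒≥ not-useful)

    PrNotUseful≤ν : 5 ℕ.* m ℕ.< n → PrNotUseful ≤ ν n
    PrNotUseful≤ν 5m<n = ≤-trans PrNotUseful≤2^m*threshold (2^m*threshold≤ν n m 5m<n)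

open import Defs
open import Data.Nat using (ℕ; _*_; _<_)
open import Data.Bool using (Bool)
open import Data.List using (List)
open import Data.Product using (Σ; _×_)
open import Data.Rational using (ℚ; 1ℚ; _-_; _≤_)
open import Relation.Binary.PropositionalEquality using (_≡_)

open ErrorBound using (ν; ν-negligible)
open UsefulStates using (PrNotUseful; PrUseful≡1-PrNotUseful; PrNotUseful≤ν)
import Data.Nat as ℕ
import Data.Nat.Properties as ℕP
open import Data.Rational.Properties using (+-monoʳ-≤; neg-antimono-≤; module ≤-Reasoning)
open import Data.Product using (_,_)

claim4p3 : Σ (ℕ → ℚ) λ ν → Negligible ν ×
    (∀ (n k m : ℕ) → 5 * k ≡ 2 * n → 5 * m < n →
    (A : Alice n m) → (rA : ℕ → List Bool) →
    1ℚ - ν n ≤ PrUseful A rA k)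
claim4p3 = ν , ν-negligible , λ n k m 5k≡2n 5m<n A rA → begin
  1ℚ - ν n
    ≤⟨ +-monoʳ-≤ 1ℚ (neg-antimono-≤ (PrNotUseful≤ν A rA k 5m<n)) ⟩
  1ℚ - PrNotUseful A rA k
    ≡⟨ PrUseful≡1-PrNotUseful A rA k (k≤n 5k≡2n) ⟨
  PrUseful A rA k ∎
  where
  open ≤-Reasoning
  k≤n : ∀ {k n} → 5 * k ≡ 2 * n → k ℕ.≤ n
  k≤n {k} 5k≡2n = ℕP.*-cancelˡ-≤ 2
    (ℕP.≤-trans (ℕP.*-monoˡ-≤ k {2} {5} (ℕP.≤ᵇ⇒≤ 2 5 _)) (ℕP.≤-reflexive 5k≡2n))
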